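{- Let $k\ge1$, $d\ge2$, fix an $\mathbb{F}_2$-linear identification of $\mathbb{F}_2^k$ with the field $\mathbb{F}_{2^k}$, and define $f:(\mathbb{F}_2^k)^d\to\mathbb{F}_2$ by $f(x_1,\dots,x_d)=\langle x_1\cdot x_2\cdots x_{d-1},x_d\rangle$, where $\cdot$ is multiplication in $\mathbb{F}_{2^k}$ and $\langle\cdot,\cdot\rangle$ is the standard inner product on $\mathbb{F}_2^k$. Then for every multilinear form $g:(\mathbb{F}_2^k)^d\to\mathbb{F}_2$ of degree at most $d-1$ respecting the block partition (i.e. $g=\sum_{S\subsetneq[d]}g_S$ where each $g_S$ depends only on the blocks $x_i$, $i\in S$, and is linear in each of them), we have $\mathrm{Corr}(f,g)\le(d-1)2^{ -k}$.
   Context: For $h:(\mathbb{F}_2^k)^d\to\mathbb{F}_2$, $\mathrm{bias}(h)=\left|\mathbb{E}_{x}(-1)^{h(x)}\right|$ with $x$ uniform, and $\mathrm{Corr}(f,g)=\mathrm{bias}(f-g)$. (For $S=\emptyset$, $g_\emptyset$ is a constant.) -}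

module Defs where

open import Data.Bool using (Bool; true; false; _xor_; _∧_; if_then_else_)
open import Data.Nat as ℕ using (ℕ; zero; suc; _*_; _^_; _∸_)
open import Data.Nat.Properties using (m^n≢0)
open import Data.Integer as ℤ using (ℤ; +_; ∣_∣)
open import Data.Rational using (ℚ; _/_)
open import Data.Fin using (Fin; fromℕ; inject₁)
open import Data.Fin.Subset using (Subset; _∈_; ⊤)
open import Data.Vec as Vec using (Vec; []; _∷_; zipWith; replicate)
import Data.Vec.Properties as VecP
open import Data.Vec.Functional as VF using (Vector; updateAt)
open import Data.List as List using (List; []; _∷_; foldr; concatMap; map; filter)
open import Data.Product using (∃; _×_)
open import Function using (_∘_; const; id)
open import Relation.Binary.PropositionalEquality using (_≡_; _≢_)
open import Relation.Nullary using (¬?)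
open import Algebra.Structures using (IsCommutativeRing)
open import Data.Bool.Properties using () renaming (_≟_ to _≟B_)

V : ℕ → Set
V k = Vec Bool k

_⊕_ : ∀ {k} → V k → V k → V k
_⊕_ = zipWith _xor_

𝟎 : ∀ {k} → V k
𝟎 = replicate _ false

⟨_,_⟩ : ∀ {k} → V k → V k → Bool
⟨ a , b ⟩ = foldr _xor_ false (Vec.toList (zipWith _∧_ a b))

-- This is exactly F_{2^k} transported along an F₂-linear identification
-- F₂^k ≅ F_{2^k} (characteristic 2, so negation is the identity).
record IsF2kField (k : ℕ) (mul : V k → V k → V k) (one : V k) : Set where
  field
    isCommutativeRing : IsCommutativeRing _≡_ _⊕_ mul id 𝟎 one
    one≢zero          : one ≢ 𝟎
    inverse           : ∀ x → x ≢ 𝟎 → ∃ λ y → mul x y ≡ one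

fFun : ∀ {k} (mul : V k → V k → V k) (one : V k) (d : ℕ) → (Fin d → V k) → Bool
fFun mul one zero    x = false
fFun mul one (suc e) x =
  ⟨ foldr mul one (List.tabulate (x ∘ inject₁)) , x (fromℕ e) ⟩

DependsOnly : ∀ {k d} → Subset d → ((Fin d → V k) → Bool) → Set
DependsOnly {k} {d} S h =
  ∀ (x y : Fin d → V k) → (∀ i → i ∈ S → x i ≡ y i) → h x ≡ h y

LinearIn : ∀ {k d} → Fin d → ((Fin d → V k) → Bool) → Set
LinearIn {k} {d} i h =
  ∀ (x : Fin d → V k) (a b : V k) →
    h (updateAt x i (const (a ⊕ b))) ≡ (h (updateAt x i (const a)) xor h (updateAt x i (const b)))

IsMultilinearOn : ∀ {k d} → Subset d → ((Fin d → V k) → Bool) → Set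
IsMultilinearOn S h = DependsOnly S h × (∀ i → i ∈ S → LinearIn i h)

allVecs : ∀ {A : Set} → List A → (n : ℕ) → List (Vec A n)
allVecs as zero    = [] ∷ []
allVecs as (suc n) = concatMap (λ a → map (a ∷_) (allVecs as n)) as

allSubsets : (d : ℕ) → List (Subset d)
allSubsets d = allVecs (false ∷ true ∷ []) d

properSubsets : (d : ℕ) → List (Subset d)
properSubsets d = filter (λ S → ¬? (VecP.≡-dec _≟B_ S ⊤)) (allSubsets d)

allPoints : (k d : ℕ) → List (Fin d → V k)
allPoints k d = map Vec.lookup (allVecs (allVecs (false ∷ true ∷ []) k) d)

sumOver : ∀ {k d} → ((S : Subset d) → (Fin d → V k) → Bool) → (Fin d → V k) → Bool
sumOver {k} {d} gS x = foldr _xor_ false (map (λ S → gS S x) (properSubsets d))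

sign : Bool → ℤ
sign false = + 1
sign true  = ℤ.- (+ 1)

bias : (k d : ℕ) → ((Fin d → V k) → Bool) → ℚ
bias k d h = (+ ∣ foldr ℤ._+_ (+ 0) (map (sign ∘ h) (allPoints k d)) ∣) / (2 ^ (k * d))
  where instance _ = m^n≢0 2 (k * d)

Corr : (k d : ℕ) → ((Fin d → V k) → Bool) → ((Fin d → V k) → Bool) → ℚ
Corr k d f g = bias k d (λ x → f x xor g x)

bound : (k d : ℕ) → ℚ
bound k d = (+ (d ∸ 1)) / (2 ^ k)
  where instance _ = m^n≢0 2 k

-- Write a point as (x, z) with z the last block, so that f(x, z) = ⟨π x, z⟩ with
-- π x = x₁ ⋯ x_{d-1}.  The pieces g_S with d ∉ S do not depend on z and the others are linear
-- in z, so g(x, z) = G₀(x) + G₁(x, z) with G₁ linear in z.  A character sum of a linear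
-- function is 0 or the number of points, in particular nonnegative, hence
--   |Σ (-1)^(f+g)| ≤ Σ_x Σ_z (-1)^(⟨π x, z⟩ + G₁(x, z)).
-- Every piece of G₁ is multilinear in a proper subset of the blocks of x, and the right-hand
-- side is at most (d-1)·2^{k(d-1)} by induction on the number of blocks: splitting off the
-- first block w, the pieces not involving w only contribute a sign in front of a character
-- sum over w that is again nonnegative, the slice w = 0 contributes 2^{k(d-1)}, and for w ≠ 0
-- the form (v, u) ↦ ⟨w v, u⟩ is still bilinear and nondegenerate because 𝔽_{2^k} has no
-- zero divisors.  With no blocks left the sum is Σ_u (-1)^⟨1, u⟩ = 0.
module Submission where

open import Defs
open import Algebra.Bundles using (CommutativeRing)
open import Algebra.Structures using (IsCommutativeRing)
import Algebra.Properties.CommutativeSemigroup as CommutativeSemigroupProperties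
open import Data.Bool using (Bool; true; false; _xor_; _∧_)
open import Data.Bool.Properties
  using (xor-same; xor-identityʳ; ∧-comm; ∧-distribʳ-xor; xor-∧-commutativeRing)
  renaming (_≟_ to _≟B_)
open import Data.Empty using (⊥-elim)
open import Data.Fin using (Fin; zero; suc; inject₁; fromℕ)
open import Data.Fin.Relation.Unary.Top using (view; ‵fromℕ; ‵inject₁)
open import Data.Fin.Subset using (Subset; ⊤; _∈_)
open import Data.Integer as ℤ using (ℤ; +_; ∣_∣; _+_; _*_) renaming (_≤_ to _≤ℤ_)
import Data.Integer.Properties as ℤP
open import Data.List as List using (List; []; _∷_; map; foldr; _++_; concatMap; length; filter)
import Data.List.Properties as ListP
open import Data.Nat as ℕ using (ℕ; zero; suc; _^_; _≤_; NonZero)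
import Data.Nat.Properties as ℕP
open import Data.Nat.Tactic.RingSolver using (solve-∀)
open import Data.Product using (∃; ∃₂; Σ-syntax; _×_; _,_; proj₁)
open import Data.Rational using (_/_) renaming (_≤_ to _≤ℚ_)
import Data.Rational.Properties as ℚP
open import Data.Rational.Unnormalised as ℚᵘ using (mkℚᵘ)
import Data.Rational.Unnormalised.Properties as ℚᵘP
open import Data.Sum using (_⊎_; inj₁; inj₂)
open import Data.Vec as Vec using (Vec; []; _∷_; lookup; _∷ʳ_; _[_]≔_; tail; initLast)
import Data.Vec.Properties as VecP
open import Data.Vec.Functional using (updateAt)
open import Function using (_∘_; const)
open import Relation.Binary.PropositionalEquality
open import Relation.Nullary using (Dec; yes; no; ¬?)

open CommutativeSemigroupProperties (CommutativeRing.+-commutativeSemigroup xor-∧-commutativeRing)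
  using () renaming (interchange to xor-interchange; x∙yz≈y∙xz to xor-left-comm)
open CommutativeSemigroupProperties ℤP.+-commutativeSemigroup
  using () renaming (interchange to +-interchange)

private variable
  A B C I : Set
  k m n : ℕ

∑ : List A → (A → ℤ) → ℤ
∑ as F = foldr _+_ (+ 0) (map F as)

infix 5 ∑
syntax ∑ as (λ a → F) = ∑[ a ← as ] F

∑-cong : ∀ (as : List A) {F G : A → ℤ} → (∀ a → F a ≡ G a) → ∑ as F ≡ ∑ as G
∑-cong []       F≡G = refl
∑-cong (a ∷ as) F≡G = cong₂ _+_ (F≡G a) (∑-cong as F≡G)

∑-mono-≤ : ∀ (as : List A) {F G : A → ℤ} → (∀ a → F a ≤ℤ G a) → ∑ as F ≤ℤ ∑ as G
∑-mono-≤ []       F≤G = ℤP.≤-refl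
∑-mono-≤ (a ∷ as) F≤G = ℤP.+-mono-≤ (F≤G a) (∑-mono-≤ as F≤G)

∑-const : ∀ (as : List A) c → ∑[ _ ← as ] + c ≡ + (length as ℕ.* c)
∑-const []       c = refl
∑-const (a ∷ as) c = trans (cong (_+_ (+ c)) (∑-const as c)) (sym (ℤP.pos-+ c _))

∑-zero : ∀ (as : List A) → ∑[ _ ← as ] + 0 ≡ + 0
∑-zero as = trans (∑-const as 0) (cong +_ (ℕP.*-zeroʳ (length as)))

∑-++ : ∀ (as bs : List A) (F : A → ℤ) → ∑ (as ++ bs) F ≡ ∑ as F + ∑ bs F
∑-++ []       bs F = sym (ℤP.+-identityˡ _)
∑-++ (a ∷ as) bs F = trans (cong (_+_ (F a)) (∑-++ as bs F)) (sym (ℤP.+-assoc (F a) _ _))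

∑-distrib-+ : ∀ (as : List A) (F G : A → ℤ) → ∑[ a ← as ] (F a + G a) ≡ ∑ as F + ∑ as G
∑-distrib-+ []       F G = refl
∑-distrib-+ (a ∷ as) F G =
  trans (cong (_+_ (F a + G a)) (∑-distrib-+ as F G)) (+-interchange (F a) (G a) _ _)

∑-*ˡ : ∀ (as : List A) c (F : A → ℤ) → ∑[ a ← as ] (c * F a) ≡ c * ∑ as F
∑-*ˡ []       c F = sym (ℤP.*-zeroʳ c)
∑-*ˡ (a ∷ as) c F = trans (cong (_+_ (c * F a)) (∑-*ˡ as c F)) (sym (ℤP.*-distribˡ-+ c (F a) _))

∣∑∣≤∑∣∣ : ∀ (as : List A) (F : A → ℤ) → + ∣ ∑ as F ∣ ≤ℤ ∑[ a ← as ] + ∣ F a ∣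
∣∑∣≤∑∣∣ []       F = ℤP.≤-refl
∣∑∣≤∑∣∣ (a ∷ as) F = begin
  + ∣ F a + ∑ as F ∣          ≤⟨ ℤ.+≤+ (ℤP.∣i+j∣≤∣i∣+∣j∣ (F a) (∑ as F)) ⟩
  + (∣ F a ∣ ℕ.+ ∣ ∑ as F ∣)  ≡⟨ ℤP.pos-+ ∣ F a ∣ _ ⟩
  + ∣ F a ∣ + + ∣ ∑ as F ∣    ≤⟨ ℤP.+-monoʳ-≤ (+ ∣ F a ∣) (∣∑∣≤∑∣∣ as F) ⟩
  ∑[ a ← a ∷ as ] + ∣ F a ∣  ∎
  where open ℤP.≤-Reasoning

∑-map : ∀ (h : A → B) (as : List A) (F : B → ℤ) → ∑ (map h as) F ≡ ∑[ a ← as ] F (h a)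
∑-map h []       F = refl
∑-map h (a ∷ as) F = cong (_+_ (F (h a))) (∑-map h as F)

∑-concatMap : ∀ (h : A → List B) (as : List A) (F : B → ℤ) →
              ∑ (concatMap h as) F ≡ ∑[ a ← as ] ∑ (h a) F
∑-concatMap h []       F = refl
∑-concatMap h (a ∷ as) F =
  trans (∑-++ (h a) (concatMap h as) F) (cong (_+_ (∑ (h a) F)) (∑-concatMap h as F))

∑-comm : ∀ (as : List A) (bs : List B) (F : A → B → ℤ) →
         ∑[ a ← as ] ∑[ b ← bs ] F a b ≡ ∑[ b ← bs ] ∑[ a ← as ] F a b
∑-comm []       bs F = sym (∑-zero bs)
∑-comm (a ∷ as) bs F = trans (cong (_+_ (∑ bs (F a))) (∑-comm as bs F))
                             (sym (∑-distrib-+ bs (F a) (λ b → ∑[ a ← as ] F a b)))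

∑-rotate : ∀ (as : List A) (bs : List B) (cs : List C) (F : A → B → C → ℤ) →
           ∑[ a ← as ] ∑[ b ← bs ] ∑[ c ← cs ] F a b c ≡ ∑[ b ← bs ] ∑[ c ← cs ] ∑[ a ← as ] F a b c
∑-rotate as bs cs F =
  trans (∑-comm as bs (λ a b → ∑[ c ← cs ] F a b c))
        (∑-cong bs (λ b → ∑-comm as cs (λ a c → F a b c)))

module _ (as : List A) where

  ∑-allVecs-∷ : ∀ n (F : Vec A (suc n) → ℤ) →
                ∑ (allVecs as (suc n)) F ≡ ∑[ a ← as ] ∑[ v ← allVecs as n ] F (a ∷ v)
  ∑-allVecs-∷ n F =
    trans (∑-concatMap _ as F) (∑-cong as (λ a → ∑-map (a ∷_) (allVecs as n) F))

  ∑-allVecs-∷ʳ : ∀ n (F : Vec A (suc n) → ℤ) →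
                 ∑ (allVecs as (suc n)) F ≡ ∑[ v ← allVecs as n ] ∑[ a ← as ] F (v ∷ʳ a)
  ∑-allVecs-∷ʳ zero    F = trans (∑-allVecs-∷ zero F)
    (trans (∑-cong as (λ a → ℤP.+-identityʳ (F (a ∷ [])))) (sym (ℤP.+-identityʳ _)))
  ∑-allVecs-∷ʳ (suc n) F = trans (∑-allVecs-∷ (suc n) F)
    (trans (∑-cong as (λ a → ∑-allVecs-∷ʳ n (F ∘ (a ∷_)))) (sym (∑-allVecs-∷ n _)))

  length-allVecs : ∀ n → length (allVecs as n) ≡ length as ^ n
  length-allVecs zero    = refl
  length-allVecs (suc n) =
    trans (length-concatMap as) (cong (length as ℕ.*_) (length-allVecs n))
    where
    length-concatMap : ∀ bs → length (concatMap (λ a → map (a ∷_) (allVecs as n)) bs)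
                              ≡ length bs ℕ.* length (allVecs as n)
    length-concatMap []       = refl
    length-concatMap (b ∷ bs) = trans (ListP.length-++ (map (b ∷_) (allVecs as n)))
      (cong₂ ℕ._+_ (ListP.length-map (b ∷_) (allVecs as n)) (length-concatMap bs))

⨁ : List I → (I → Bool) → Bool
⨁ J f = foldr _xor_ false (map f J)

⨁-cong : ∀ (J : List I) {f g : I → Bool} → (∀ j → f j ≡ g j) → ⨁ J f ≡ ⨁ J g
⨁-cong []      f≡g = refl
⨁-cong (j ∷ J) f≡g = cong₂ _xor_ (f≡g j) (⨁-cong J f≡g)

⨁-distrib-xor : ∀ (J : List I) (f g : I → Bool) → ⨁ J (λ j → f j xor g j) ≡ ⨁ J f xor ⨁ J g
⨁-distrib-xor []      f g = refl
⨁-distrib-xor (j ∷ J) f g =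
  trans (cong (_xor_ (f j xor g j)) (⨁-distrib-xor J f g)) (xor-interchange (f j) (g j) _ _)

⨁-false : ∀ (J : List I) {f : I → Bool} → (∀ j → f j ≡ false) → ⨁ J f ≡ false
⨁-false []      f≡0 = refl
⨁-false (j ∷ J) {f} f≡0 = trans (cong (_xor ⨁ J f) (f≡0 j)) (⨁-false J f≡0)

bools : List Bool
bools = false ∷ true ∷ []

sign-xor : ∀ a b → sign (a xor b) ≡ sign a * sign b
sign-xor false false = refl
sign-xor false true  = refl
sign-xor true  false = refl
sign-xor true  true  = refl

∣sign*∣ : ∀ a i → ∣ sign a * i ∣ ≡ ∣ i ∣
∣sign*∣ false i = cong ∣_∣ (ℤP.*-identityˡ i)
∣sign*∣ true  i = trans (cong ∣_∣ (ℤP.-1*i≡-i i)) (ℤP.∣-i∣≡∣i∣ i)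

sign*≤ : ∀ a {i} → + 0 ≤ℤ i → sign a * i ≤ℤ i
sign*≤ false {i}   _ = ℤP.≤-reflexive (ℤP.*-identityˡ i)
sign*≤ true  {+ n} _ = ℤP.≤-trans (ℤP.≤-reflexive (ℤP.-1*i≡-i (+ n))) ℤP.neg-≤-pos

⊕-identityˡ : ∀ (v : V n) → 𝟎 ⊕ v ≡ v
⊕-identityˡ = VecP.zipWith-identityˡ (λ _ → refl)

⊕-self : ∀ (v : V n) → v ⊕ v ≡ 𝟎
⊕-self []      = refl
⊕-self (b ∷ v) = cong₂ _∷_ (xor-same b) (⊕-self v)

Linear : (V n → Bool) → Set
Linear f = ∀ a b → f (a ⊕ b) ≡ f a xor f b

Linear-𝟎 : ∀ (f : V n → Bool) → Linear f → f 𝟎 ≡ false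
Linear-𝟎 f lin = trans (cong f (sym (⊕-self 𝟎))) (trans (lin 𝟎 𝟎) (xor-same (f 𝟎)))

Linear-xor : ∀ (f g : V n → Bool) → Linear f → Linear g → Linear (λ v → f v xor g v)
Linear-xor f g f-lin g-lin a b =
  trans (cong₂ _xor_ (f-lin a b) (g-lin a b)) (xor-interchange (f a) (f b) (g a) (g b))

⨁-Linear : ∀ (J : List I) {f : I → V n → Bool} →
           (∀ j → Linear (f j)) → Linear (λ v → ⨁ J (λ j → f j v))
⨁-Linear J lin a b = trans (⨁-cong J (λ j → lin j a b)) (⨁-distrib-xor J _ _)

module CharacterSumStep {n : ℕ} (f : V (suc n) → Bool) (lin : Linear f) where

  restriction : V n → Bool
  restriction v = f (false ∷ v)

  restriction-linear : Linear restriction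
  restriction-linear a b = lin (false ∷ a) (false ∷ b)

  c : Bool
  c = f (true ∷ 𝟎)

  f-true : ∀ v → f (true ∷ v) ≡ c xor restriction v
  f-true v = trans (cong (λ u → f (true ∷ u)) (sym (⊕-identityˡ v))) (lin (true ∷ 𝟎) (false ∷ v))

  S : ℤ
  S = ∑[ v ← allVecs bools n ] sign (restriction v)

  ∑-sign-split : ∑[ v ← allVecs bools (suc n) ] sign (f v) ≡ S + sign c * S
  ∑-sign-split = trans (∑-allVecs-∷ bools n (sign ∘ f)) (cong (_+_ S) (begin
    (∑[ v ← allVecs bools n ] sign (f (true ∷ v))) + + 0 ≡⟨ ℤP.+-identityʳ _ ⟩
    ∑[ v ← allVecs bools n ] sign (f (true ∷ v))
      ≡⟨ ∑-cong (allVecs bools n) (λ v → trans (cong sign (f-true v)) (sign-xor c _)) ⟩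
    ∑[ v ← allVecs bools n ] (sign c * sign (restriction v))
      ≡⟨ ∑-*ˡ (allVecs bools n) (sign c) (sign ∘ restriction) ⟩
    sign c * S ∎))
    where open ≡-Reasoning

i+sign[true]*i≡0 : ∀ i → i + sign true * i ≡ + 0
i+sign[true]*i≡0 i = trans (cong (_+_ i) (ℤP.-1*i≡-i i)) (ℤP.+-inverseʳ i)

i+sign*i≥0 : ∀ b {i} → + 0 ≤ℤ i → + 0 ≤ℤ i + sign b * i
i+sign*i≥0 false {i} i≥0 =
  ℤP.≤-trans (ℤP.+-mono-≤ i≥0 i≥0) (ℤP.≤-reflexive (cong (_+_ i) (sym (ℤP.*-identityˡ i))))
i+sign*i≥0 true  {i} _   = ℤP.≤-reflexive (sym (i+sign[true]*i≡0 i))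

∑-sign-linear-nonneg : ∀ n (f : V n → Bool) → Linear f →
                       + 0 ≤ℤ ∑[ v ← allVecs bools n ] sign (f v)
∑-sign-linear-nonneg zero    f lin rewrite Linear-𝟎 f lin = ℤ.+≤+ ℕ.z≤n
∑-sign-linear-nonneg (suc n) f lin = ℤP.≤-trans
  (i+sign*i≥0 c (∑-sign-linear-nonneg n restriction restriction-linear))
  (ℤP.≤-reflexive (sym ∑-sign-split))
  where open CharacterSumStep f lin

∑-sign-linear≡0 : ∀ n (f : V n → Bool) → Linear f → ∀ u → f u ≡ true →
                  ∑[ v ← allVecs bools n ] sign (f v) ≡ + 0
∑-sign-linear≡0 zero    f lin [] fu≡1 with () ← trans (sym fu≡1) (Linear-𝟎 f lin)
∑-sign-linear≡0 (suc n) f lin (b ∷ u) fu≡1 = trans ∑-sign-split (by-c c refl)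
  where
  open CharacterSumStep f lin
  by-c : ∀ c′ → c′ ≡ c → S + sign c′ * S ≡ + 0
  by-c true  _   = i+sign[true]*i≡0 S
  by-c false c≡0 = cong (λ t → t + sign false * t)
    (∑-sign-linear≡0 n restriction restriction-linear u (restriction-u b fu≡1))
    where
    restriction-u : ∀ b → f (b ∷ u) ≡ true → restriction u ≡ true
    restriction-u false fu≡1 = fu≡1
    restriction-u true  fu≡1 =
      trans (cong (_xor restriction u) c≡0) (trans (sym (f-true u)) fu≡1)

⟨⟩-comm : ∀ (a b : V n) → ⟨ a , b ⟩ ≡ ⟨ b , a ⟩
⟨⟩-comm []      []      = refl
⟨⟩-comm (x ∷ a) (y ∷ b) = cong₂ _xor_ (∧-comm x y) (⟨⟩-comm a b)

⟨⟩-linearˡ : ∀ (u : V n) → Linear (λ v → ⟨ v , u ⟩)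
⟨⟩-linearˡ []      []      []      = refl
⟨⟩-linearˡ (c ∷ u) (a ∷ v) (b ∷ w) = trans (cong₂ _xor_ (∧-distribʳ-xor c a b) (⟨⟩-linearˡ u v w))
  (xor-interchange (a ∧ c) (b ∧ c) ⟨ v , u ⟩ ⟨ w , u ⟩)

⟨⟩-linearʳ : ∀ (v : V n) → Linear (λ u → ⟨ v , u ⟩)
⟨⟩-linearʳ v a b = trans (⟨⟩-comm v (a ⊕ b))
  (trans (⟨⟩-linearˡ v a b) (cong₂ _xor_ (⟨⟩-comm a v) (⟨⟩-comm b v)))

⟨⟩-zeroʳ : ∀ (v : V n) → ⟨ v , 𝟎 ⟩ ≡ false
⟨⟩-zeroʳ v = trans (⟨⟩-comm v 𝟎) (Linear-𝟎 (λ w → ⟨ w , v ⟩) (⟨⟩-linearˡ v))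

⟨⟩-nondegenerate : ∀ (v : V n) → v ≢ 𝟎 → ∃ λ u → ⟨ v , u ⟩ ≡ true
⟨⟩-nondegenerate []          v≢𝟎 = ⊥-elim (v≢𝟎 refl)
⟨⟩-nondegenerate (true ∷ v)  _   = true ∷ 𝟎 , cong (true xor_) (⟨⟩-zeroʳ v)
⟨⟩-nondegenerate (false ∷ v) v≢𝟎 with ⟨⟩-nondegenerate v (v≢𝟎 ∘ cong (false ∷_))
... | u , ⟨v,u⟩≡1 = false ∷ u , ⟨v,u⟩≡1

lookup-∷ʳ-inject₁ : ∀ (x : Vec A n) z i → lookup (x ∷ʳ z) (inject₁ i) ≡ lookup x i
lookup-∷ʳ-inject₁ (a ∷ x) z zero    = refl
lookup-∷ʳ-inject₁ (a ∷ x) z (suc i) = lookup-∷ʳ-inject₁ x z i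

lookup-∷ʳ-fromℕ : ∀ (x : Vec A n) z → lookup (x ∷ʳ z) (fromℕ n) ≡ z
lookup-∷ʳ-fromℕ []      z = refl
lookup-∷ʳ-fromℕ (a ∷ x) z = lookup-∷ʳ-fromℕ x z

[]≔-∷ʳ : ∀ (x : Vec A n) z i c j →
         lookup ((x [ i ]≔ c) ∷ʳ z) j ≡ updateAt (lookup (x ∷ʳ z)) (inject₁ i) (const c) j
[]≔-∷ʳ (a ∷ x) z zero    c zero    = refl
[]≔-∷ʳ (a ∷ x) z zero    c (suc j) = refl
[]≔-∷ʳ (a ∷ x) z (suc i) c zero    = refl
[]≔-∷ʳ (a ∷ x) z (suc i) c (suc j) = []≔-∷ʳ x z i c j

∷ʳ-updateAt-fromℕ : ∀ (x : Vec A n) z c j →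
                    lookup (x ∷ʳ c) j ≡ updateAt (lookup (x ∷ʳ z)) (fromℕ n) (const c) j
∷ʳ-updateAt-fromℕ []      z c zero    = refl
∷ʳ-updateAt-fromℕ (a ∷ x) z c zero    = refl
∷ʳ-updateAt-fromℕ (a ∷ x) z c (suc j) = ∷ʳ-updateAt-fromℕ x z c j

⊤∷ʳtrue : ∀ n → ⊤ {n} ∷ʳ true ≡ ⊤
⊤∷ʳtrue zero    = refl
⊤∷ʳtrue (suc n) = cong (true ∷_) (⊤∷ʳtrue n)

Form : ℕ → ℕ → Set
Form k m = Vec (V k) m → V k → Bool

SupportedOn : Vec Bool m → Form k m → Set
SupportedOn T P = ∀ x y u → (∀ i → lookup T i ≡ true → lookup x i ≡ lookup y i) → P x u ≡ P y u

LinearOn : Vec Bool m → Form k m → Set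
LinearOn T P = ∀ i → lookup T i ≡ true → ∀ x a b u →
  P (x [ i ]≔ (a ⊕ b)) u ≡ P (x [ i ]≔ a) u xor P (x [ i ]≔ b) u

-- The vanishing alternative is needed for m = 0, where no T ≢ ⊤ exists.
ProperForm : Vec Bool m → Form k m → Set
ProperForm T P = (T ≢ ⊤ × SupportedOn T P × LinearOn T P) ⊎ (∀ x u → P x u ≡ false)

-- A sum of forms each multilinear in a proper subset of the blocks of x, presented by
-- peeling off the first block.
LowDegree : ∀ m → Form k m → Set
LowDegree zero    H = ∀ u → H [] u ≡ false
LowDegree (suc m) H = Σ[ H₀ ∈ Form _ m ] Σ[ H₁ ∈ (V _ → Form _ m) ]
  (∀ w x u → H (w ∷ x) u ≡ H₀ x u xor H₁ w x u) ×
  (∀ x u → Linear (λ w → H₁ w x u)) ×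
  (∀ w → LowDegree m (H₁ w))

headFree : Vec Bool (suc m) → Form k (suc m) → Form k m
headFree (false ∷ _) P x u = P (𝟎 ∷ x) u
headFree (true  ∷ _) P x u = false

headPart : Vec Bool (suc m) → Form k (suc m) → V k → Form k m
headPart (false ∷ _) P w x u = false
headPart (true  ∷ _) P w x u = P (w ∷ x) u

headFree-xor-headPart : ∀ (T : Vec Bool (suc m)) (P : Form k (suc m)) → ProperForm T P →
  ∀ w x u → P (w ∷ x) u ≡ headFree T P x u xor headPart T P w x u
headFree-xor-headPart (true  ∷ _) P _        w x u = refl
headFree-xor-headPart (false ∷ _) P (inj₂ P≡0) w x u =
  trans (P≡0 (w ∷ x) u) (sym (cong (_xor false) (P≡0 (𝟎 ∷ x) u)))
headFree-xor-headPart (false ∷ _) P (inj₁ (_ , supported , _)) w x u =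
  trans (supported (w ∷ x) (𝟎 ∷ x) u agree) (sym (xor-identityʳ _))
  where
  agree : ∀ i → lookup (false ∷ _) i ≡ true → lookup (w ∷ x) i ≡ lookup (𝟎 ∷ x) i
  agree zero    ()
  agree (suc i) _ = refl

headPart-linear : ∀ (T : Vec Bool (suc m)) (P : Form k (suc m)) → ProperForm T P →
  ∀ x u → Linear (λ w → headPart T P w x u)
headPart-linear (false ∷ _) P _          x u a b = refl
headPart-linear (true  ∷ _) P (inj₂ P≡0) x u a b =
  trans (P≡0 _ u) (sym (cong₂ _xor_ (P≡0 _ u) (P≡0 _ u)))
headPart-linear (true  ∷ _) P (inj₁ (_ , _ , linear)) x u a b = linear zero refl (𝟎 ∷ x) a b u

headPart-proper : ∀ (T : Vec Bool (suc m)) (P : Form k (suc m)) → ProperForm T P →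
  ∀ w → ProperForm (tail T) (headPart T P w)
headPart-proper (false ∷ _)  P _          w = inj₂ (λ _ _ → refl)
headPart-proper (true  ∷ _)  P (inj₂ P≡0) w = inj₂ (λ x u → P≡0 (w ∷ x) u)
headPart-proper (true  ∷ T) P (inj₁ (T≢⊤ , supported , linear)) w =
  inj₁ (T≢⊤ ∘ cong (true ∷_) , supported′ , λ i t x → linear (suc i) t (w ∷ x))
  where
  supported′ : SupportedOn T (headPart (true ∷ T) P w)
  supported′ x y u agree = supported (w ∷ x) (w ∷ y) u λ where
    zero    _ → refl
    (suc i) t → agree i t

⨁-ProperForm-LowDegree : ∀ m (J : List I) (P : I → Form k m) (T : I → Vec Bool m) →
  (∀ j → ProperForm (T j) (P j)) → LowDegree m (λ x u → ⨁ J (λ j → P j x u))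
⨁-ProperForm-LowDegree zero J P T proper u = ⨁-false J vanishes
  where
  vanishes : ∀ j → P j [] u ≡ false
  vanishes j with T j | proper j
  ... | [] | inj₁ ([]≢⊤ , _) = ⊥-elim ([]≢⊤ refl)
  ... | [] | inj₂ P≡0 = P≡0 [] u
⨁-ProperForm-LowDegree (suc m) J P T proper =
    (λ x u → ⨁ J (λ j → headFree (T j) (P j) x u))
  , (λ w x u → ⨁ J (λ j → headPart (T j) (P j) w x u))
  , (λ w x u → trans (⨁-cong J (λ j → headFree-xor-headPart (T j) (P j) (proper j) w x u))
                     (⨁-distrib-xor J _ _))
  , (λ x u → ⨁-Linear J (λ j → headPart-linear (T j) (P j) (proper j) x u))
  , (λ w → ⨁-ProperForm-LowDegree m J (λ j → headPart (T j) (P j) w) (tail ∘ T)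
                                   (λ j → headPart-proper (T j) (P j) (proper j) w))

DependsOnly-≗ : ∀ {S : Subset m} {h : (Fin m → V k) → Bool} → DependsOnly S h →
                ∀ p q → (∀ j → p j ≡ q j) → h p ≡ h q
DependsOnly-≗ dep p q p≗q = dep p q (λ j _ → p≗q j)

restrict : ((Fin (suc m) → V k) → Bool) → Form k m
restrict h x z = h (lookup (x ∷ʳ z))

module _ {T : Vec Bool m} {b : Bool} {h : (Fin (suc m) → V k) → Bool} where

  restrict-supportedOn : IsMultilinearOn (T ∷ʳ b) h → SupportedOn T (restrict h)
  restrict-supportedOn (dep , _) x y u agree = dep _ _ agree∷ʳ
    where
    agree∷ʳ : ∀ j → j ∈ T ∷ʳ b → lookup (x ∷ʳ u) j ≡ lookup (y ∷ʳ u) j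
    agree∷ʳ j j∈S with view j
    ... | ‵fromℕ     = trans (lookup-∷ʳ-fromℕ x u) (sym (lookup-∷ʳ-fromℕ y u))
    ... | ‵inject₁ i = begin
      lookup (x ∷ʳ u) (inject₁ i) ≡⟨ lookup-∷ʳ-inject₁ x u i ⟩
      lookup x i                  ≡⟨ agree i i∈T ⟩
      lookup y i                  ≡⟨ lookup-∷ʳ-inject₁ y u i ⟨
      lookup (y ∷ʳ u) (inject₁ i) ∎
      where
      open ≡-Reasoning
      i∈T = trans (sym (lookup-∷ʳ-inject₁ T b i)) (VecP.[]=⇒lookup j∈S)

  restrict-linearOn : IsMultilinearOn (T ∷ʳ b) h → LinearOn T (restrict h)
  restrict-linearOn (dep , lin) i i∈T x a c u = begin
    h (lookup ((x [ i ]≔ (a ⊕ c)) ∷ʳ u))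
      ≡⟨ DependsOnly-≗ dep _ _ ([]≔-∷ʳ x u i (a ⊕ c)) ⟩
    h (updateAt p (inject₁ i) (const (a ⊕ c)))
      ≡⟨ lin (inject₁ i) i∈S p a c ⟩
    h (updateAt p (inject₁ i) (const a)) xor h (updateAt p (inject₁ i) (const c))
      ≡⟨ cong₂ _xor_ (DependsOnly-≗ dep _ _ ([]≔-∷ʳ x u i a))
                     (DependsOnly-≗ dep _ _ ([]≔-∷ʳ x u i c)) ⟨
    h (lookup ((x [ i ]≔ a) ∷ʳ u)) xor h (lookup ((x [ i ]≔ c) ∷ʳ u)) ∎
    where
    open ≡-Reasoning
    p = lookup (x ∷ʳ u)
    i∈S = VecP.lookup⇒[]= (inject₁ i) (T ∷ʳ b) (trans (lookup-∷ʳ-inject₁ T b i) i∈T)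

module _ {T : Vec Bool m} {h : (Fin (suc m) → V k) → Bool} where

  restrict-linear-last : IsMultilinearOn (T ∷ʳ true) h → ∀ x → Linear (restrict h x)
  restrict-linear-last (dep , lin) x a c = begin
    h (lookup (x ∷ʳ (a ⊕ c)))
      ≡⟨ DependsOnly-≗ dep _ _ (∷ʳ-updateAt-fromℕ x 𝟎 (a ⊕ c)) ⟩
    h (updateAt p (fromℕ m) (const (a ⊕ c)))
      ≡⟨ lin (fromℕ m) last∈S p a c ⟩
    h (updateAt p (fromℕ m) (const a)) xor h (updateAt p (fromℕ m) (const c))
      ≡⟨ cong₂ _xor_ (DependsOnly-≗ dep _ _ (∷ʳ-updateAt-fromℕ x 𝟎 a))
                     (DependsOnly-≗ dep _ _ (∷ʳ-updateAt-fromℕ x 𝟎 c)) ⟨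
    h (lookup (x ∷ʳ a)) xor h (lookup (x ∷ʳ c)) ∎
    where
    open ≡-Reasoning
    p = lookup (x ∷ʳ 𝟎)
    last∈S = VecP.lookup⇒[]= (fromℕ m) (T ∷ʳ true) (lookup-∷ʳ-fromℕ T true)

  restrict-const-last : IsMultilinearOn (T ∷ʳ false) h → ∀ x z → restrict h x z ≡ restrict h x 𝟎
  restrict-const-last (dep , _) x z = dep _ _ agree
    where
    agree : ∀ j → j ∈ T ∷ʳ false → lookup (x ∷ʳ z) j ≡ lookup (x ∷ʳ 𝟎) j
    agree j j∈S with view j
    ... | ‵fromℕ with () ← trans (sym (lookup-∷ʳ-fromℕ T false)) (VecP.[]=⇒lookup j∈S)
    ... | ‵inject₁ i = trans (lookup-∷ʳ-inject₁ x z i) (sym (lookup-∷ʳ-inject₁ x 𝟎 i))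

module LastBlock {k e : ℕ} (gS : (S : Subset (suc e)) → (Fin (suc e) → V k) → Bool)
                 (gS-multilinear : ∀ S → S ≢ ⊤ → IsMultilinearOn S (gS S)) where

  _≟⊤ : (S : Subset (suc e)) → Dec (S ≡ ⊤)
  S ≟⊤ = VecP.≡-dec _≟B_ S ⊤

  piece : (S : Subset (suc e)) → Dec (S ≡ ⊤) → (Fin (suc e) → V k) → Bool
  piece S (yes _) p = false
  piece S (no _)  p = gS S p

  piece-multilinear : ∀ S (S≟⊤ : Dec (S ≡ ⊤)) → IsMultilinearOn S (piece S S≟⊤)
  piece-multilinear S (yes _)   = (λ _ _ _ → refl) , (λ _ _ _ _ _ → refl)
  piece-multilinear S (no S≢⊤) = gS-multilinear S S≢⊤

  piece-⊤ : ∀ {S} → S ≡ ⊤ → ∀ (S≟⊤ : Dec (S ≡ ⊤)) p → piece S S≟⊤ p ≡ false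
  piece-⊤ S≡⊤ (yes _)   p = refl
  piece-⊤ S≡⊤ (no S≢⊤) p = ⊥-elim (S≢⊤ S≡⊤)

  sumOver≡⨁piece : ∀ p → sumOver gS p ≡ ⨁ (allSubsets (suc e)) (λ S → piece S (S ≟⊤) p)
  sumOver≡⨁piece p = go (allSubsets (suc e))
    where
    go : ∀ Ss → ⨁ (filter (λ S → ¬? (S ≟⊤)) Ss) (λ S → gS S p) ≡ ⨁ Ss (λ S → piece S (S ≟⊤) p)
    go []       = refl
    go (S ∷ Ss) with S ≟⊤
    ... | yes _ = go Ss
    ... | no _  = cong (_xor_ (gS S p)) (go Ss)

  Split : Subset (suc e) → Set
  Split S = ∃₂ λ T b → S ≡ T ∷ʳ b

  -- The pieces with d ∉ S, evaluated at z = 𝟎, make up G₀; the others make up G₁.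
  g₀ : ∀ S → Split S → Vec (V k) e → Bool
  g₀ S (_ , true  , _) x = false
  g₀ S (_ , false , _) x = restrict (piece S (S ≟⊤)) x 𝟎

  g₁ : ∀ S → Split S → Form k e
  g₁ S (_ , true  , _)     = restrict (piece S (S ≟⊤))
  g₁ S (_ , false , _) x z = false

  piece-split : ∀ S (s : Split S) x z → restrict (piece S (S ≟⊤)) x z ≡ g₀ S s x xor g₁ S s x z
  piece-split S (T , true  , refl) x z = refl
  piece-split S (T , false , refl) x z =
    trans (restrict-const-last (piece-multilinear S (S ≟⊤)) x z) (sym (xor-identityʳ _))

  g₁-linear : ∀ S (s : Split S) x → Linear (g₁ S s x)
  g₁-linear S (T , true  , refl) = restrict-linear-last (piece-multilinear S (S ≟⊤))
  g₁-linear S (T , false , refl) x a c = refl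

  g₁-proper : ∀ S (s : Split S) → ProperForm (proj₁ s) (g₁ S s)
  g₁-proper S (T , false , refl) = inj₂ (λ _ _ → refl)
  g₁-proper S (T , true  , refl) with VecP.≡-dec _≟B_ T ⊤
  ... | yes refl = inj₂ (λ x z → piece-⊤ (⊤∷ʳtrue e) (S ≟⊤) _)
  ... | no T≢⊤  = inj₁ (T≢⊤ , restrict-supportedOn S-multilinear , restrict-linearOn S-multilinear)
    where S-multilinear = piece-multilinear S (S ≟⊤)

  G₀ : Vec (V k) e → Bool
  G₀ x = ⨁ (allSubsets (suc e)) (λ S → g₀ S (initLast S) x)

  G₁ : Form k e
  G₁ x z = ⨁ (allSubsets (suc e)) (λ S → g₁ S (initLast S) x z)

  sumOver-split : ∀ x z → sumOver gS (lookup (x ∷ʳ z)) ≡ G₀ x xor G₁ x z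
  sumOver-split x z = trans (sumOver≡⨁piece _)
    (trans (⨁-cong (allSubsets (suc e)) (λ S → piece-split S (initLast S) x z))
           (⨁-distrib-xor (allSubsets (suc e)) _ _))

  G₁-linear : ∀ x → Linear (G₁ x)
  G₁-linear x = ⨁-Linear (allSubsets (suc e)) (λ S → g₁-linear S (initLast S) x)

  G₁-lowDegree : LowDegree e G₁
  G₁-lowDegree = ⨁-ProperForm-LowDegree e (allSubsets (suc e)) (λ S → g₁ S (initLast S))
    (λ S → proj₁ (initLast S)) (λ S → g₁-proper S (initLast S))

atZero : ℤ → V n → ℤ
atZero c []          = c
atZero c (false ∷ v) = atZero c v
atZero c (true  ∷ v) = + 0

atZero-𝟎 : ∀ n c → atZero c (𝟎 {n}) ≡ c
atZero-𝟎 zero    c = refl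
atZero-𝟎 (suc n) c = atZero-𝟎 n c

atZero-≢𝟎 : ∀ c (w : V n) → w ≢ 𝟎 → atZero c w ≡ + 0
atZero-≢𝟎 c []          w≢𝟎 = ⊥-elim (w≢𝟎 refl)
atZero-≢𝟎 c (false ∷ w) w≢𝟎 = atZero-≢𝟎 c w (w≢𝟎 ∘ cong (false ∷_))
atZero-≢𝟎 c (true  ∷ w) _   = refl

∑-atZero : ∀ n c → ∑ (allVecs bools n) (atZero c) ≡ c
∑-atZero zero    c = ℤP.+-identityʳ c
∑-atZero (suc n) c = trans (∑-allVecs-∷ bools n (atZero c))
  (trans (cong₂ _+_ (∑-atZero n c) (trans (ℤP.+-identityʳ _) (∑-zero (allVecs bools n))))
         (ℤP.+-identityʳ c))

module InField {k : ℕ} {mul : V k → V k → V k} {one : V k} (𝔽 : IsF2kField k mul one) where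

  open IsF2kField 𝔽
  open IsCommutativeRing isCommutativeRing
    using (*-identityˡ; *-comm; *-assoc; zeroˡ; zeroʳ; distribˡ; distribʳ)

  points : List (V k)
  points = allVecs bools k

  N : ℕ
  N = length points

  π : Vec (V k) m → V k
  π []       = one
  π (x ∷ xs) = mul x (π xs)

  mul-≢𝟎 : ∀ {w v} → w ≢ 𝟎 → v ≢ 𝟎 → mul w v ≢ 𝟎
  mul-≢𝟎 {w} {v} w≢𝟎 v≢𝟎 wv≡𝟎 with inverse w w≢𝟎
  ... | w⁻¹ , ww⁻¹≡1 = v≢𝟎 (begin
    v                   ≡⟨ *-identityˡ v ⟨
    mul one v           ≡⟨ cong (λ a → mul a v) (trans (sym ww⁻¹≡1) (*-comm w w⁻¹)) ⟩
    mul (mul w⁻¹ w) v   ≡⟨ *-assoc w⁻¹ w v ⟩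
    mul w⁻¹ (mul w v)   ≡⟨ cong (mul w⁻¹) wv≡𝟎 ⟩
    mul w⁻¹ 𝟎           ≡⟨ zeroʳ w⁻¹ ⟩
    𝟎                   ∎)
    where open ≡-Reasoning

  record IsNondegenerateBilinear (β : V k → V k → Bool) : Set where
    field
      linearˡ       : ∀ u → Linear (λ v → β v u)
      linearʳ       : ∀ v → Linear (β v)
      nondegenerate : ∀ v → v ≢ 𝟎 → ∃ λ u → β v u ≡ true

  open IsNondegenerateBilinear

  ∘mul-nondegenerate : ∀ {β} → IsNondegenerateBilinear β → ∀ {w} → w ≢ 𝟎 →
                       IsNondegenerateBilinear (β ∘ mul w)
  ∘mul-nondegenerate {β} β-nd {w} w≢𝟎 = record
    { linearˡ       = λ u a b → trans (cong (λ v → β v u) (distribˡ w a b)) (linearˡ β-nd u _ _)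
    ; linearʳ       = λ v → linearʳ β-nd (mul w v)
    ; nondegenerate = λ v v≢𝟎 → nondegenerate β-nd (mul w v) (mul-≢𝟎 w≢𝟎 v≢𝟎)
    }

  ⟨⟩-isNondegenerateBilinear : IsNondegenerateBilinear ⟨_,_⟩
  ⟨⟩-isNondegenerateBilinear = record
    { linearˡ = ⟨⟩-linearˡ ; linearʳ = ⟨⟩-linearʳ ; nondegenerate = ⟨⟩-nondegenerate }

  fFun-∷ʳ : ∀ (x : Vec (V k) m) z → fFun mul one (suc m) (lookup (x ∷ʳ z)) ≡ ⟨ π x , z ⟩
  fFun-∷ʳ x z = cong₂ ⟨_,_⟩
    (trans (cong (foldr mul one) (ListP.tabulate-cong (lookup-∷ʳ-inject₁ x z))) (foldr-tabulate x))
    (lookup-∷ʳ-fromℕ x z)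
    where
    foldr-tabulate : ∀ (x : Vec (V k) n) → foldr mul one (List.tabulate (lookup x)) ≡ π x
    foldr-tabulate []      = refl
    foldr-tabulate (a ∷ x) = cong (mul a) (foldr-tabulate x)

  formSum : ∀ m → (V k → V k → Bool) → Form k m → ℤ
  formSum m β H = ∑[ x ← allVecs points m ] ∑[ u ← points ] sign (β (π x) u xor H x u)

  formSum-trivial : ∀ m β (H : Form k m) → (∀ x u → β (π x) u xor H x u ≡ false) →
                    formSum m β H ≡ + (N ^ m ℕ.* N)
  formSum-trivial m β H vanishes = begin
    formSum m β H
      ≡⟨ ∑-cong xs (λ x →
           trans (∑-cong points (λ u → cong sign (vanishes x u))) (∑-const points 1)) ⟩
    ∑[ _ ← xs ] + (N ℕ.* 1)
      ≡⟨ ∑-const xs _ ⟩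
    + (length xs ℕ.* (N ℕ.* 1))
      ≡⟨ cong +_ (cong₂ ℕ._*_ (length-allVecs points m) (ℕP.*-identityʳ N)) ⟩
    + (N ^ m ℕ.* N) ∎
    where
    open ≡-Reasoning
    xs = allVecs points m

  formSum-∘mul≤ : ∀ m β (H₀ : Form k m) (H₁ : V k → Form k m) H →
    (∀ u → Linear (λ v → β v u)) →
    (∀ w x u → H (w ∷ x) u ≡ H₀ x u xor H₁ w x u) →
    (∀ x u → Linear (λ w → H₁ w x u)) →
    formSum (suc m) β H ≤ℤ ∑[ w ← points ] formSum m (β ∘ mul w) (H₁ w)
  -- H₀ x u does not involve w, and what remains of the sum over w is a nonnegative character sum.
  formSum-∘mul≤ m β H₀ H₁ H β-linearˡ split H₁-linear = begin
    formSum (suc m) β H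
      ≡⟨ ∑-allVecs-∷ points m _ ⟩
    ∑[ w ← points ] ∑[ x ← xs ] ∑[ u ← points ] sign (β (mul w (π x)) u xor H (w ∷ x) u)
      ≡⟨ ∑-cong points (λ w → ∑-cong xs (λ x → ∑-cong points (λ u → sign-split w x u))) ⟩
    ∑[ w ← points ] ∑[ x ← xs ] ∑[ u ← points ] (sign (H₀ x u) * sign (Φ w x u))
      ≡⟨ ∑-rotate points xs points _ ⟩
    ∑[ x ← xs ] ∑[ u ← points ] ∑[ w ← points ] (sign (H₀ x u) * sign (Φ w x u))
      ≡⟨ ∑-cong xs (λ x → ∑-cong points (λ u → ∑-*ˡ points (sign (H₀ x u)) _)) ⟩
    ∑[ x ← xs ] ∑[ u ← points ] (sign (H₀ x u) * (∑[ w ← points ] sign (Φ w x u)))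
      ≤⟨ ∑-mono-≤ xs (λ x → ∑-mono-≤ points (λ u →
           sign*≤ (H₀ x u) (∑-sign-linear-nonneg k (λ w → Φ w x u) (Φ-linear x u)))) ⟩
    ∑[ x ← xs ] ∑[ u ← points ] ∑[ w ← points ] sign (Φ w x u)
      ≡⟨ ∑-rotate points xs points _ ⟨
    ∑[ w ← points ] formSum m (β ∘ mul w) (H₁ w) ∎
    where
    open ℤP.≤-Reasoning
    xs = allVecs points m
    Φ : V k → Form k m
    Φ w x u = β (mul w (π x)) u xor H₁ w x u
    sign-split : ∀ w x u → sign (β (mul w (π x)) u xor H (w ∷ x) u) ≡ sign (H₀ x u) * sign (Φ w x u)
    sign-split w x u = trans (cong (λ h → sign (β (mul w (π x)) u xor h)) (split w x u))
      (trans (cong sign (xor-left-comm (β (mul w (π x)) u) (H₀ x u) (H₁ w x u)))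
             (sign-xor (H₀ x u) _))
    Φ-linear : ∀ x u → Linear (λ w → Φ w x u)
    Φ-linear x u = Linear-xor (λ w → β (mul w (π x)) u) (λ w → H₁ w x u)
      (λ a b → trans (cong (λ v → β v u) (distribʳ (π x) a b)) (β-linearˡ u _ _)) (H₁-linear x u)

  formSum≤ : ∀ m β → IsNondegenerateBilinear β → ∀ H → LowDegree m H →
             formSum m β H ≤ℤ + (m ℕ.* N ^ m)
  formSum≤ zero β β-nd H H≡0 with nondegenerate β-nd one one≢zero
  ... | u , β1u≡1 = ℤP.≤-reflexive (begin
    (∑[ u ← points ] sign (β one u xor H [] u)) + + 0 ≡⟨ ℤP.+-identityʳ _ ⟩
    ∑[ u ← points ] sign (β one u xor H [] u)
      ≡⟨ ∑-cong points (λ u → cong (λ h → sign (β one u xor h)) (H≡0 u)) ⟩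
    ∑[ u ← points ] sign (β one u xor false)
      ≡⟨ ∑-cong points (λ u → cong sign (xor-identityʳ (β one u))) ⟩
    ∑[ u ← points ] sign (β one u)
      ≡⟨ ∑-sign-linear≡0 k (β one) (linearʳ β-nd one) u β1u≡1 ⟩
    + 0 ∎)
    where open ≡-Reasoning
  formSum≤ (suc m) β β-nd H (H₀ , H₁ , split , H₁-linear , H₁-low) = begin
    formSum (suc m) β H
      ≤⟨ formSum-∘mul≤ m β H₀ H₁ H (linearˡ β-nd) split H₁-linear ⟩
    ∑[ w ← points ] formSum m (β ∘ mul w) (H₁ w)
      ≤⟨ ∑-mono-≤ points slice≤ ⟩
    ∑[ w ← points ] (atZero (+ (N ^ m ℕ.* N)) w + + (m ℕ.* N ^ m))
      ≡⟨ ∑-distrib-+ points _ _ ⟩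
    ∑ points (atZero (+ (N ^ m ℕ.* N))) + (∑[ _ ← points ] + (m ℕ.* N ^ m))
      ≡⟨ cong₂ _+_ (∑-atZero k _) (∑-const points _) ⟩
    + (N ^ m ℕ.* N) + + (N ℕ.* (m ℕ.* N ^ m))
      ≡⟨ ℤP.pos-+ (N ^ m ℕ.* N) _ ⟨
    + (N ^ m ℕ.* N ℕ.+ N ℕ.* (m ℕ.* N ^ m))
      ≡⟨ cong +_ (count (N ^ m) N m) ⟩
    + (suc m ℕ.* N ^ suc m) ∎
    where
    open ℤP.≤-Reasoning
    count : ∀ p N m → p ℕ.* N ℕ.+ N ℕ.* (m ℕ.* p) ≡ suc m ℕ.* (N ℕ.* p)
    count = solve-∀
    slice𝟎-vanishes : ∀ x u → β (mul 𝟎 (π x)) u xor H₁ 𝟎 x u ≡ false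
    slice𝟎-vanishes x u = cong₂ _xor_
      (trans (cong (λ v → β v u) (zeroˡ (π x))) (Linear-𝟎 (λ v → β v u) (linearˡ β-nd u)))
      (Linear-𝟎 (λ w → H₁ w x u) (H₁-linear x u))
    slice≤ : ∀ w → formSum m (β ∘ mul w) (H₁ w) ≤ℤ atZero (+ (N ^ m ℕ.* N)) w + + (m ℕ.* N ^ m)
    slice≤ w with VecP.≡-dec _≟B_ w 𝟎
    ... | yes refl = ℤP.≤-trans
      (ℤP.≤-reflexive (trans (formSum-trivial m (β ∘ mul 𝟎) (H₁ 𝟎) slice𝟎-vanishes)
                             (sym (atZero-𝟎 k _))))
      (ℤP.i≤i+j _ (+ (m ℕ.* N ^ m)))
    ... | no w≢𝟎 = ℤP.≤-trans
      (formSum≤ m _ (∘mul-nondegenerate β-nd w≢𝟎) (H₁ w) (H₁-low w))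
      (ℤP.≤-reflexive (sym (trans (cong (_+ _) (atZero-≢𝟎 _ w w≢𝟎)) (ℤP.+-identityˡ _))))

∣∑sign[f+g]∣≤ : ∀ {k e} {mul : V k → V k → V k} {one : V k} → IsF2kField k mul one →
  ∀ (gS : (S : Subset (suc e)) → (Fin (suc e) → V k) → Bool) →
  (∀ S → S ≢ ⊤ → IsMultilinearOn S (gS S)) →
  ∀ (g : (Fin (suc e) → V k) → Bool) → (∀ p → g p ≡ sumOver gS p) →
  + ∣ ∑[ p ← allPoints k (suc e) ] sign (fFun mul one (suc e) p xor g p) ∣ ≤ℤ + (e ℕ.* (2 ^ k) ^ e)
∣∑sign[f+g]∣≤ {k} {e} {mul} {one} 𝔽 gS gS-multilinear g g≡ = begin
  + ∣ ∑ (allPoints k (suc e)) (sign ∘ h) ∣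
    ≡⟨ cong (+_ ∘ ∣_∣) (trans (∑-map lookup (allVecs points (suc e)) (sign ∘ h))
                              (∑-allVecs-∷ʳ points e _)) ⟩
  + ∣ ∑[ x ← xs ] ∑[ z ← points ] sign (h (lookup (x ∷ʳ z))) ∣
    ≡⟨ cong (+_ ∘ ∣_∣) (∑-cong xs (λ x →
         trans (∑-cong points (sign-split x)) (∑-*ˡ points (sign (G₀ x)) _))) ⟩
  + ∣ ∑[ x ← xs ] (sign (G₀ x) * inner x) ∣
    ≤⟨ ∣∑∣≤∑∣∣ xs _ ⟩
  ∑[ x ← xs ] + ∣ sign (G₀ x) * inner x ∣
    ≡⟨ ∑-cong xs (λ x → trans (cong +_ (∣sign*∣ (G₀ x) _)) (ℤP.0≤i⇒+∣i∣≡i (inner-nonneg x))) ⟩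
  formSum e ⟨_,_⟩ G₁
    ≤⟨ formSum≤ e ⟨_,_⟩ ⟨⟩-isNondegenerateBilinear G₁ G₁-lowDegree ⟩
  + (e ℕ.* N ^ e)
    ≡⟨ cong (λ n → + (e ℕ.* n ^ e)) (length-allVecs bools k) ⟩
  + (e ℕ.* (2 ^ k) ^ e) ∎
  where
  open ℤP.≤-Reasoning
  open InField 𝔽
  open LastBlock gS gS-multilinear
  h : (Fin (suc e) → V k) → Bool
  h p = fFun mul one (suc e) p xor g p
  xs = allVecs points e
  inner : Vec (V k) e → ℤ
  inner x = ∑[ z ← points ] sign (⟨ π x , z ⟩ xor G₁ x z)
  inner-nonneg : ∀ x → + 0 ≤ℤ inner x
  inner-nonneg x = ∑-sign-linear-nonneg k (λ z → ⟨ π x , z ⟩ xor G₁ x z)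
    (Linear-xor (λ z → ⟨ π x , z ⟩) (G₁ x) (⟨⟩-linearʳ (π x)) (G₁-linear x))
  sign-split : ∀ x z → sign (h (lookup (x ∷ʳ z))) ≡ sign (G₀ x) * sign (⟨ π x , z ⟩ xor G₁ x z)
  sign-split x z = begin-equality
    sign (h (lookup (x ∷ʳ z)))
      ≡⟨ cong sign (cong₂ _xor_ (fFun-∷ʳ x z) (trans (g≡ (lookup (x ∷ʳ z))) (sumOver-split x z))) ⟩
    sign (⟨ π x , z ⟩ xor (G₀ x xor G₁ x z))
      ≡⟨ cong sign (xor-left-comm ⟨ π x , z ⟩ (G₀ x) (G₁ x z)) ⟩
    sign (G₀ x xor (⟨ π x , z ⟩ xor G₁ x z))
      ≡⟨ sign-xor (G₀ x) _ ⟩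
    sign (G₀ x) * sign (⟨ π x , z ⟩ xor G₁ x z) ∎

+a/b≤+c/d : ∀ a c b d .{{_ : NonZero b}} .{{_ : NonZero d}} →
            a ℕ.* d ℕ.≤ c ℕ.* b → (+ a) / b ≤ℚ (+ c) / d
+a/b≤+c/d a c (suc b) (suc d) ad≤cb = ℚP.toℚᵘ-cancel-≤
  (ℚᵘP.≤-respˡ-≃ (ℚᵘP.≃-sym (ℚP.toℚᵘ-fromℚᵘ (mkℚᵘ (+ a) b)))
  (ℚᵘP.≤-respʳ-≃ (ℚᵘP.≃-sym (ℚP.toℚᵘ-fromℚᵘ (mkℚᵘ (+ c) d)))
  (ℚᵘ.*≤* (ℤP.≤-trans (ℤP.≤-reflexive (sym (ℤP.pos-* a (suc d))))
          (ℤP.≤-trans (ℤ.+≤+ ad≤cb) (ℤP.≤-reflexive (ℤP.pos-* c (suc b))))))))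

bias≤bound : ∀ k e (h : (Fin (suc e) → V k) → Bool) →
  + ∣ ∑[ p ← allPoints k (suc e) ] sign (h p) ∣ ≤ℤ + (e ℕ.* (2 ^ k) ^ e) →
  bias k (suc e) h ≤ℚ bound k (suc e)
bias≤bound k e h ∣∑∣≤ = +a/b≤+c/d ∣Σ∣ e (2 ^ (k ℕ.* suc e)) (2 ^ k)
  {{ℕP.m^n≢0 2 (k ℕ.* suc e)}} {{ℕP.m^n≢0 2 k}} (begin
    ∣Σ∣ ℕ.* 2 ^ k                   ≤⟨ ℕP.*-monoˡ-≤ (2 ^ k) (ℤP.drop‿+≤+ ∣∑∣≤) ⟩
    e ℕ.* (2 ^ k) ^ e ℕ.* 2 ^ k     ≡⟨ ℕP.*-assoc e _ _ ⟩
    e ℕ.* ((2 ^ k) ^ e ℕ.* 2 ^ k)   ≡⟨ cong (e ℕ.*_) (ℕP.*-comm ((2 ^ k) ^ e) _) ⟩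
    e ℕ.* (2 ^ k) ^ suc e           ≡⟨ cong (e ℕ.*_) (ℕP.^-*-assoc 2 k (suc e)) ⟩
    e ℕ.* 2 ^ (k ℕ.* suc e)         ∎)
  where
  open ℕP.≤-Reasoning
  ∣Σ∣ = ∣ ∑[ p ← allPoints k (suc e) ] sign (h p) ∣

lemma3p12 : (k d : ℕ) → 1 ≤ k → 2 ≤ d →
    (mul : V k → V k → V k) (one : V k) → IsF2kField k mul one →
    (g : (Fin d → V k) → Bool) →
    (gS : (S : Subset d) → (Fin d → V k) → Bool) →
    (∀ S → S ≢ ⊤ → IsMultilinearOn S (gS S)) →
    (∀ x → g x ≡ sumOver gS x) →
    Corr k d (fFun mul one d) g ≤ℚ bound k d
lemma3p12 k zero    _ () _ _ _ _ _ _ _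
lemma3p12 k (suc e) _ _  mul one 𝔽 g gS gS-multilinear g≡ =
  bias≤bound k e (λ p → fFun mul one (suc e) p xor g p) (∣∑sign[f+g]∣≤ 𝔽 gS gS-multilinear g g≡)
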